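{- Let $r\ge 2$ be an integer. If $G$ is an $r$-BG graph with at least $r+1$ vertices, then $G$ has at most $r$ blocks. Moreover, when $r\ge 3$, $G$ has exactly $r$ blocks only if $G=K_{1,r}$.
   Context: Bootstrap percolation with threshold $r$ on a finite simple graph $G$: starting from an initially infected set $A_0\subseteq V(G)$, define $A_t=A_{t-1}\cup\{v\in V(G): |N(v)\cap A_{t-1}|\ge r\}$ for $t\ge1$; $A_0$ percolates if eventually every vertex is infected. $G$ is $r$-bootstrap good ($r$-BG) if it contains a set of $r$ vertices which percolates with threshold $r$. A block of $G$ is a maximal connected subgraph of $G$ with no cut vertex (so a bridge together with its ends forms a block). -}

module Defs where

open import Data.Nat using (ℕ; zero; suc; _≤ᵇ_; _≤_)
open import Data.Bool using (Bool; true; false; _∨_; _xor_)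
open import Data.Fin using (Fin; zero; suc)
open import Data.Fin.Subset using (Subset; _∈_; _∉_; _∩_; ∁; ⁅_⁆; ∣_∣; _⊂_)
open import Data.Vec using (tabulate; lookup)
open import Data.Product using (Σ; Σ-syntax; ∃; ∃-syntax; _×_)
open import Data.Empty using (⊥)
open import Relation.Binary.PropositionalEquality using (_≡_)
open import Function.Bundles using (_↔_; Inverse)
open import Function.Definitions using (Injective)
open import Relation.Nullary using (¬_)

record Graph (n : ℕ) : Set where
  field
    adj    : Fin n → Fin n → Bool
    sym    : ∀ u v → adj u v ≡ adj v u
    irrefl : ∀ v → adj v v ≡ false
open Graph public

module _ {n : ℕ} (G : Graph n) where

  N : Fin n → Subset n
  N v = tabulate (adj G v)

  step : ℕ → Subset n → Subset n
  step r A = tabulate λ v → lookup A v ∨ (r ≤ᵇ ∣ N v ∩ A ∣)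

  infected : ℕ → Subset n → ℕ → Subset n
  infected r A zero    = A
  infected r A (suc t) = step r (infected r A t)

  Percolates : ℕ → Subset n → Set
  Percolates r A = ∃[ t ] (∀ v → v ∈ infected r A t)

  BootstrapGood : ℕ → Set
  BootstrapGood r = ∃[ A ] (∣ A ∣ ≡ r × Percolates r A)

  -- walks inside the vertex set S (i.e. in the induced subgraph G[S])
  data PathIn (S : Subset n) : Fin n → Fin n → Set where
    here : ∀ {u} → u ∈ S → PathIn S u u
    there : ∀ {u w v} → u ∈ S → adj G u w ≡ true → PathIn S w v → PathIn S u v

  AllJoined : Subset n → Set
  AllJoined S = ∀ u v → u ∈ S → v ∈ S → PathIn S u v

  ConnectedSet : Subset n → Set
  ConnectedSet S = (∃[ v ] v ∈ S) × AllJoined S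

  NoCutVertex : Subset n → Set
  NoCutVertex S = ∀ v → v ∈ S → AllJoined (S ∩ ∁ ⁅ v ⁆)

  Good : Subset n → Set
  Good S = ConnectedSet S × NoCutVertex S

  -- S is (the vertex set of) a block: maximal connected without cut vertex
  IsBlock : Subset n → Set
  IsBlock S = Good S × (∀ T → S ⊂ T → ¬ Good T)

  -- G has exactly k blocks: an injective enumeration of all blocks by Fin k
  NumBlocks : ℕ → Set
  NumBlocks k = Σ[ B ∈ (Fin k → Subset n) ]
      (Injective _≡_ _≡_ B × (∀ i → IsBlock (B i)) × (∀ S → IsBlock S → ∃[ i ] S ≡ B i))

_≅_ : ∀ {n m} → Graph n → Graph m → Set
_≅_ {n} {m} G H = Σ[ f ∈ Fin n ↔ Fin m ]
  (∀ u v → adj G u v ≡ adj H (Inverse.to f u) (Inverse.to f v))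

private
  isZero : ∀ {m} → Fin m → Bool
  isZero zero    = true
  isZero (suc _) = false

  xor-self : ∀ b → (b xor b) ≡ false
  xor-self true  = Relation.Binary.PropositionalEquality.refl
  xor-self false = Relation.Binary.PropositionalEquality.refl

  xor-comm : ∀ a b → (a xor b) ≡ (b xor a)
  xor-comm true  true  = Relation.Binary.PropositionalEquality.refl
  xor-comm true  false = Relation.Binary.PropositionalEquality.refl
  xor-comm false true  = Relation.Binary.PropositionalEquality.refl
  xor-comm false false = Relation.Binary.PropositionalEquality.refl

-- the star K_{1,r} on Fin (suc r), centre zero: u ~ v iff exactly one is the centre
Star : (r : ℕ) → Graph (suc r)
Star r = record
  { adj    = λ u v → isZero u xor isZero v
  ; sym    = λ u v → xor-comm (isZero u) (isZero v)
  ; irrefl = λ v → xor-self (isZero v)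
  }

-- Let A, with |A| = r, percolate, and let x be the first vertex outside A to be infected: x is
-- adjacent to every vertex of A. A vertex whose component in G - c misses A has at most one
-- infected neighbour (c) at any time, so for r ≥ 2 it is never infected. Hence every block B
-- contains x (otherwise B is left towards x through a single vertex c, which separates the
-- rest of B from A) and a vertex of A (otherwise x separates the rest of B from A). Two blocks
-- share at most one vertex, so choosing a vertex of A in each block is injective: at most r
-- blocks. With exactly r blocks this choice is a bijection onto A, so no 2-connected set, in
-- particular no cycle, contains x and two vertices of A. So A is independent
-- and no vertex outside A ∪ {x} has two neighbours in A; for r ≥ 3 such a vertex is never
-- infected, and G is the star with centre x.

module Submission where

open import Defs hiding (sym)
open import Data.Nat using (ℕ; zero; suc; _≤_; _<_; _+_; z≤n; s≤s; _≤ᵇ_)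
open import Data.Nat.Properties
  using (≤-pred; ≤-trans; ≤-reflexive; <-≤-trans; <-irrefl; +-suc; n≤1+n; ≤ᵇ⇒≤)
open import Data.Bool using (Bool; true; false; _∨_; T)
open import Data.Fin using (Fin; zero; suc; _≟_)
open import Data.Fin.Properties using (any?; suc-injective; 0≢1+n)
open import Data.Fin.Subset
  using (Subset; _∈_; _∉_; _⊆_; _∩_; _∪_; ∁; ⁅_⁆; ∣_∣; _-_; Nonempty; ⊤)
open import Data.Fin.Subset.Properties
  using ( x∈p∩q⁺; x∈p∩q⁻; x∈p∪q⁺; x∈p∪q⁻; x∉p⇒x∈∁p; x∈∁p⇒x∉p; x≢y⇒x∉⁅y⁆; x∈⁅x⁆; x∈⁅y⁆⇒x≡y
        ; _∈?_; ∈⊤; ⊆-antisym; p⊆p∪q; q⊆p∪q; nonempty?; Empty-unique; ∣⊥∣≡0; p⊆q⇒∣p∣≤∣q∣; ∣⁅x⁆∣≡1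
        ; x∈p∧x≢y⇒x∈p-y; x∈p⇒∣p-x∣<∣p∣; ∣⊤∣≡n)
open import Data.Vec using ([]; _∷_; lookup; tabulate)
open import Data.Vec.Properties using ([]=⇒lookup; lookup⇒[]=; lookup∘tabulate)
open import Data.Product using (Σ-syntax; ∃-syntax; _×_; _,_; proj₁; proj₂)
open import Data.Sum using (_⊎_; inj₁; inj₂; [_,_]′)
open import Data.Empty using (⊥; ⊥-elim)
open import Data.Unit using (tt) renaming (⊤ to Unit)
open import Relation.Nullary using (¬_; Dec; yes; no; does)
open import Relation.Nullary.Decidable using (_⊎-dec_; _×-dec_; ¬?; decidable-stable)
open import Relation.Binary.PropositionalEquality using (_≡_; refl; sym; trans; cong; cong₂; subst; _≢_)
open import Function.Definitions using (Injective)
open import Function.Bundles using (mk↔ₛ′)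
open import Function.Base using (_∘_)

variable
  n k : ℕ

infixl 7 _∖_

_∖_ : Subset n → Fin n → Subset n
S ∖ v = S ∩ ∁ ⁅ v ⁆

x∈p∧x≢y⇒x∈p∖y : ∀ {S : Subset n} {z v} → z ∈ S → z ≢ v → z ∈ S ∖ v
x∈p∧x≢y⇒x∈p∖y z∈S z≢v = x∈p∩q⁺ (z∈S , x∉p⇒x∈∁p (x≢y⇒x∉⁅y⁆ z≢v))

x∈p∖y⇒x∈p : ∀ {S : Subset n} {z v} → z ∈ S ∖ v → z ∈ S
x∈p∖y⇒x∈p {S = S} {v = v} z∈S∖v = proj₁ (x∈p∩q⁻ S (∁ ⁅ v ⁆) z∈S∖v)

x∈p∖y⇒x≢y : ∀ {S : Subset n} {z v} → z ∈ S ∖ v → z ≢ v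
x∈p∖y⇒x≢y {S = S} {v = v} z∈S∖v refl = x∈∁p⇒x∉p (proj₂ (x∈p∩q⁻ S (∁ ⁅ v ⁆) z∈S∖v)) (x∈⁅x⁆ v)

∖-mono : ∀ {S T : Subset n} {v} → S ⊆ T → S ∖ v ⊆ T ∖ v
∖-mono S⊆T z∈S∖v = x∈p∧x≢y⇒x∈p∖y (S⊆T (x∈p∖y⇒x∈p z∈S∖v)) (x∈p∖y⇒x≢y z∈S∖v)

x∈p∪q∖y⁻ : ∀ (S T : Subset n) {z v} → z ∈ (S ∪ T) ∖ v → z ∈ S ∖ v ⊎ z ∈ T ∖ v
x∈p∪q∖y⁻ S T z∈ with x∈p∪q⁻ S T (x∈p∖y⇒x∈p z∈)
... | inj₁ z∈S = inj₁ (x∈p∧x≢y⇒x∈p∖y z∈S (x∈p∖y⇒x≢y z∈))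
... | inj₂ z∈T = inj₂ (x∈p∧x≢y⇒x∈p∖y z∈T (x∈p∖y⇒x≢y z∈))

x∈⁅y⁆∪⁅z⁆⁻ : ∀ {x y z : Fin n} → x ∈ ⁅ y ⁆ ∪ ⁅ z ⁆ → x ≡ y ⊎ x ≡ z
x∈⁅y⁆∪⁅z⁆⁻ {y = y} {z} x∈ with x∈p∪q⁻ ⁅ y ⁆ ⁅ z ⁆ x∈
... | inj₁ x∈y = inj₁ (x∈⁅y⁆⇒x≡y y x∈y)
... | inj₂ x∈z = inj₂ (x∈⁅y⁆⇒x≡y z x∈z)

tabulate-∈⁺ : (f : Fin n → Bool) {z : Fin n} → f z ≡ true → z ∈ tabulate f
tabulate-∈⁺ f {z} fz = lookup⇒[]= z (tabulate f) (trans (lookup∘tabulate f z) fz)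

tabulate-∈⁻ : (f : Fin n → Bool) {z : Fin n} → z ∈ tabulate f → f z ≡ true
tabulate-∈⁻ f {z} z∈ = trans (sym (lookup∘tabulate f z)) ([]=⇒lookup z∈)

∣p∪q∣≤∣p∣+∣q∣ : (p q : Subset n) → ∣ p ∪ q ∣ ≤ ∣ p ∣ + ∣ q ∣
∣p∪q∣≤∣p∣+∣q∣ []          []          = z≤n
∣p∪q∣≤∣p∣+∣q∣ (true ∷ p)  (true ∷ q)  = s≤s (≤-trans (∣p∪q∣≤∣p∣+∣q∣ p q)
                                          (≤-trans (n≤1+n _) (≤-reflexive (sym (+-suc ∣ p ∣ ∣ q ∣)))))
∣p∪q∣≤∣p∣+∣q∣ (true ∷ p)  (false ∷ q) = s≤s (∣p∪q∣≤∣p∣+∣q∣ p q)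
∣p∪q∣≤∣p∣+∣q∣ (false ∷ p) (true ∷ q)  = ≤-trans (s≤s (∣p∪q∣≤∣p∣+∣q∣ p q)) (≤-reflexive (sym (+-suc ∣ p ∣ ∣ q ∣)))
∣p∪q∣≤∣p∣+∣q∣ (false ∷ p) (false ∷ q) = ∣p∪q∣≤∣p∣+∣q∣ p q

∣p∣≤1+∣p∖x∣ : (p : Subset n) (x : Fin n) → ∣ p ∣ ≤ suc ∣ p ∖ x ∣
∣p∣≤1+∣p∖x∣ p x = ≤-trans (p⊆q⇒∣p∣≤∣q∣ p⊆x∪p∖x)
                          (≤-trans (∣p∪q∣≤∣p∣+∣q∣ ⁅ x ⁆ (p ∖ x)) (≤-reflexive (cong (_+ ∣ p ∖ x ∣) (∣⁅x⁆∣≡1 x))))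
  where
  p⊆x∪p∖x : p ⊆ ⁅ x ⁆ ∪ p ∖ x
  p⊆x∪p∖x {z} z∈p with z ≟ x
  ... | yes refl = x∈p∪q⁺ (inj₁ (x∈⁅x⁆ x))
  ... | no z≢x   = x∈p∪q⁺ (inj₂ (x∈p∧x≢y⇒x∈p∖y z∈p z≢x))

1≤∣p∣⇒nonempty : (p : Subset n) → 1 ≤ ∣ p ∣ → Nonempty p
1≤∣p∣⇒nonempty {n} p 1≤∣p∣ with nonempty? p
... | yes ne = ne
... | no ¬ne with ≤-trans 1≤∣p∣ (≤-reflexive (trans (cong ∣_∣ (Empty-unique ¬ne)) (∣⊥∣≡0 n)))
...   | ()

2≤∣p∣⇒∃≢ : (p : Subset n) (x : Fin n) → 2 ≤ ∣ p ∣ → ∃[ y ] (y ∈ p × y ≢ x)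
2≤∣p∣⇒∃≢ p x 2≤∣p∣ with 1≤∣p∣⇒nonempty (p ∖ x) (≤-pred (≤-trans 2≤∣p∣ (∣p∣≤1+∣p∖x∣ p x)))
... | y , y∈p∖x = y , x∈p∖y⇒x∈p y∈p∖x , x∈p∖y⇒x≢y y∈p∖x

3≤∣p∣⇒∃₂≢ : (p : Subset n) (x : Fin n) → 3 ≤ ∣ p ∣ → ∃[ a ] ∃[ b ] (a ∈ p ∖ x × b ∈ p ∖ x × a ≢ b)
3≤∣p∣⇒∃₂≢ p x 3≤∣p∣ = pick (≤-pred (≤-trans 3≤∣p∣ (∣p∣≤1+∣p∖x∣ p x)))
  where
  pick : 2 ≤ ∣ p ∖ x ∣ → ∃[ a ] ∃[ b ] (a ∈ p ∖ x × b ∈ p ∖ x × a ≢ b)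
  pick 2≤∣p∖x∣ with 1≤∣p∣⇒nonempty (p ∖ x) (≤-trans (s≤s z≤n) 2≤∣p∖x∣)
  ... | a , a∈p∖x with 2≤∣p∣⇒∃≢ (p ∖ x) a 2≤∣p∖x∣
  ...   | b , b∈p∖x , b≢a = a , b , a∈p∖x , b∈p∖x , b≢a ∘ sym

injection⇒≤∣p∣ : (p : Subset n) (f : Fin k → Fin n) → Injective _≡_ _≡_ f → (∀ i → f i ∈ p) → k ≤ ∣ p ∣
injection⇒≤∣p∣ {k = zero}  p f f-inj f∈p = z≤n
injection⇒≤∣p∣ {k = suc k} p f f-inj f∈p =
  <-≤-trans (s≤s (injection⇒≤∣p∣ (p - f zero) (f ∘ suc) (suc-injective ∘ f-inj) f∘suc∈p-f₀))
            (x∈p⇒∣p-x∣<∣p∣ (f∈p zero))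
  where
  f∘suc∈p-f₀ : ∀ i → f (suc i) ∈ p - f zero
  f∘suc∈p-f₀ i = x∈p∧x≢y⇒x∈p-y (f∈p (suc i)) (λ eq → 0≢1+n (sym (f-inj eq)))

injection-onto : (p : Subset n) (f : Fin k → Fin n) → Injective _≡_ _≡_ f → (∀ i → f i ∈ p) →
                 ∣ p ∣ ≤ k → ∀ {z} → z ∈ p → ∃[ i ] f i ≡ z
injection-onto {k = k} p f f-inj f∈p ∣p∣≤k {z} z∈p with any? (λ i → f i ≟ z)
... | yes hit  = hit
... | no ¬hit = ⊥-elim (<-irrefl refl (<-≤-trans (x∈p⇒∣p-x∣<∣p∣ z∈p) (≤-trans ∣p∣≤k k≤∣p-z∣)))
  where
  k≤∣p-z∣ : k ≤ ∣ p - z ∣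
  k≤∣p-z∣ = injection⇒≤∣p∣ (p - z) f f-inj (λ i → x∈p∧x≢y⇒x∈p-y (f∈p i) (λ eq → ¬hit (i , eq)))

p⊆q∧∣q∣≤∣p∣⇒q⊆p : {p q : Subset n} → p ⊆ q → ∣ q ∣ ≤ ∣ p ∣ → q ⊆ p
p⊆q∧∣q∣≤∣p∣⇒q⊆p {p = p} {q} p⊆q ∣q∣≤∣p∣ {z} z∈q with z ∈? p
... | yes z∈p = z∈p
... | no z∉p  = ⊥-elim (<-irrefl refl (<-≤-trans (x∈p⇒∣p-x∣<∣p∣ z∈q) (≤-trans ∣q∣≤∣p∣ (p⊆q⇒∣p∣≤∣q∣ p⊆q-z))))
  where
  p⊆q-z : p ⊆ q - z
  p⊆q-z y∈p = x∈p∧x≢y⇒x∈p-y (p⊆q y∈p) (λ { refl → z∉p y∈p })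

module Walks (G : Graph n) where

  infix 4 _~_
  _~_ : Fin n → Fin n → Set
  u ~ v = adj G u v ≡ true

  ~-sym : ∀ {u v} → u ~ v → v ~ u
  ~-sym {u} {v} u~v = trans (Graph.sym G v u) u~v

  ~⇒≢ : ∀ {u v} → u ~ v → u ≢ v
  ~⇒≢ {u} u~u refl with trans (sym u~u) (irrefl G u)
  ... | ()

  head∈ : ∀ {S u v} → PathIn G S u v → u ∈ S
  head∈ (here u∈S)      = u∈S
  head∈ (there u∈S _ _) = u∈S

  last∈ : ∀ {S u v} → PathIn G S u v → v ∈ S
  last∈ (here v∈S)    = v∈S
  last∈ (there _ _ p) = last∈ p

  PathIn-mono : ∀ {S T u v} → S ⊆ T → PathIn G S u v → PathIn G T u v
  PathIn-mono S⊆T (here u∈S)        = here (S⊆T u∈S)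
  PathIn-mono S⊆T (there u∈S u~w p) = there (S⊆T u∈S) u~w (PathIn-mono S⊆T p)

  infixr 5 _++_
  _++_ : ∀ {S u v w} → PathIn G S u v → PathIn G S v w → PathIn G S u w
  here _         ++ q = q
  there u∈S u~w p ++ q = there u∈S u~w (p ++ q)

  snoc : ∀ {S u v w} → PathIn G S u v → v ~ w → w ∈ S → PathIn G S u w
  snoc p v~w w∈S = p ++ there (last∈ p) v~w (here w∈S)

  reverse : ∀ {S u v} → PathIn G S u v → PathIn G S v u
  reverse (here u∈S)        = here u∈S
  reverse (there u∈S u~w p) = snoc (reverse p) (~-sym u~w) u∈S

  infix 4 _∈ᵥ_ _∈ᵥ?_
  _∈ᵥ_ : ∀ {S u v} → Fin n → PathIn G S u v → Set
  z ∈ᵥ here {u} _      = z ≡ u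
  z ∈ᵥ there {u} _ _ p = z ≡ u ⊎ z ∈ᵥ p

  _∈ᵥ?_ : ∀ {S u v} (z : Fin n) (p : PathIn G S u v) → Dec (z ∈ᵥ p)
  z ∈ᵥ? here {u} _      = z ≟ u
  z ∈ᵥ? there {u} _ _ p = (z ≟ u) ⊎-dec (z ∈ᵥ? p)

  ∈ᵥ⇒∈ : ∀ {S u v z} (p : PathIn G S u v) → z ∈ᵥ p → z ∈ S
  ∈ᵥ⇒∈ (here u∈S)      refl        = u∈S
  ∈ᵥ⇒∈ (there u∈S _ _) (inj₁ refl) = u∈S
  ∈ᵥ⇒∈ (there _ _ p)   (inj₂ z∈p)  = ∈ᵥ⇒∈ p z∈p

  head∈ᵥ : ∀ {S u v} (p : PathIn G S u v) → u ∈ᵥ p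
  head∈ᵥ (here _)      = refl
  head∈ᵥ (there _ _ _) = inj₁ refl

  last∈ᵥ : ∀ {S u v} (p : PathIn G S u v) → v ∈ᵥ p
  last∈ᵥ (here _)      = refl
  last∈ᵥ (there _ _ p) = inj₂ (last∈ᵥ p)

  restrict : ∀ {S T u v} (p : PathIn G S u v) → (∀ z → z ∈ᵥ p → z ∈ T) → PathIn G T u v
  restrict (here _)        p⊆T = here (p⊆T _ refl)
  restrict (there _ u~w p) p⊆T = there (p⊆T _ (inj₁ refl)) u~w (restrict p (λ z z∈p → p⊆T z (inj₂ z∈p)))

  vertices : ∀ {S u v} → PathIn G S u v → Subset n
  vertices p = tabulate (λ z → does (z ∈ᵥ? p))

  ∈vertices⁺ : ∀ {S u v z} (p : PathIn G S u v) → z ∈ᵥ p → z ∈ vertices p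
  ∈vertices⁺ {z = z} p z∈p with z ∈ᵥ? p in eq
  ... | yes _   = tabulate-∈⁺ (λ y → does (y ∈ᵥ? p)) (cong does eq)
  ... | no z∉p = ⊥-elim (z∉p z∈p)

  ∈vertices⁻ : ∀ {S u v z} (p : PathIn G S u v) → z ∈ vertices p → z ∈ᵥ p
  ∈vertices⁻ {z = z} p z∈p with z ∈ᵥ? p | tabulate-∈⁻ (λ y → does (y ∈ᵥ? p)) z∈p
  ... | yes z∈ᵥp | _ = z∈ᵥp

  Simple : ∀ {S u v} → PathIn G S u v → Set
  Simple (here _)          = Unit
  Simple (there {u} _ _ p) = ¬ (u ∈ᵥ p) × Simple p

  suffix : ∀ {S u w z} (p : PathIn G S u w) → z ∈ᵥ p → Σ[ q ∈ PathIn G S z w ] (∀ y → y ∈ᵥ q → y ∈ᵥ p)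
  suffix (here u∈S)        refl        = here u∈S , λ _ y∈q → y∈q
  suffix (there u∈S u~w p) (inj₁ refl) = there u∈S u~w p , λ _ y∈q → y∈q
  suffix (there _ _ p)     (inj₂ z∈p)  with suffix p z∈p
  ... | q , q⊆p = q , λ y y∈q → inj₂ (q⊆p y y∈q)

  suffix-simple : ∀ {S u w z} (p : PathIn G S u w) → Simple p → z ∈ᵥ p → Σ[ q ∈ PathIn G S z w ] Simple q
  suffix-simple (here u∈S)        _          refl        = here u∈S , tt
  suffix-simple (there u∈S u~w p) p-simple   (inj₁ refl) = there u∈S u~w p , p-simple
  suffix-simple (there _ _ p)     (_ , p-simple) (inj₂ z∈p) = suffix-simple p p-simple z∈p

  simplify : ∀ {S u w} → PathIn G S u w → Σ[ q ∈ PathIn G S u w ] Simple q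
  simplify (here u∈S) = here u∈S , tt
  simplify (there {u} u∈S u~w p) with simplify p
  ... | q , q-simple with u ∈ᵥ? q
  ...   | yes u∈q = suffix-simple q q-simple u∈q
  ...   | no u∉q  = there u∈S u~w q , u∉q , q-simple

  Avoiding : ∀ {S u w} → PathIn G S u w → Fin n → Fin n → Fin n → Set
  Avoiding {S} Q v a b = Σ[ q ∈ PathIn G S a b ] (∀ y → y ∈ᵥ q → y ∈ᵥ Q × y ≢ v)

  Avoiding-there : ∀ {S u u′ w v a b} (u∈S : u ∈ S) (u~u′ : u ~ u′) {Q : PathIn G S u′ w} →
                   Avoiding Q v a b → Avoiding (there u∈S u~u′ Q) v a b
  Avoiding-there _ _ (q , q⊆Q-v) = q , λ y y∈q → inj₂ (proj₁ (q⊆Q-v y y∈q)) , proj₂ (q⊆Q-v y y∈q)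

  suffix-avoiding : ∀ {S u w z v} (Q : PathIn G S u w) → z ∈ᵥ Q → ¬ (v ∈ᵥ Q) → Avoiding Q v z w
  suffix-avoiding Q z∈Q v∉Q with suffix Q z∈Q
  ... | q , q⊆Q = q , λ y y∈q → q⊆Q y y∈q , λ { refl → v∉Q (q⊆Q y y∈q) }

  simple-split : ∀ {S u w z v} (Q : PathIn G S u w) → Simple Q → z ∈ᵥ Q → z ≢ v →
                 Avoiding Q v z w ⊎ Avoiding Q v u z
  simple-split (here u∈S) _ refl z≢v = inj₁ (here u∈S , λ { _ refl → refl , z≢v })
  simple-split {v = v} (there u∈S u~u′ Q) _ (inj₁ refl) z≢v with v ∈ᵥ? Q
  ... | yes _   = inj₂ (here u∈S , λ { _ refl → inj₁ refl , z≢v })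
  ... | no v∉Q = inj₁ (there u∈S u~u′ Q , λ { _ y∈ → y∈ , λ { refl → [ z≢v ∘ sym , v∉Q ]′ y∈ } })
  simple-split {v = v} (there {u} u∈S u~u′ Q) (u∉Q , Q-simple) (inj₂ z∈Q) z≢v
    with simple-split Q Q-simple z∈Q z≢v
  ... | inj₁ tail = inj₁ (Avoiding-there u∈S u~u′ tail)
  ... | inj₂ (q , q⊆Q-v) with u ≟ v
  ...   | no u≢v  = inj₂ (there u∈S u~u′ q , λ { _ (inj₁ refl) → inj₁ refl , u≢v
                                                ; y (inj₂ y∈q) → inj₂ (proj₁ (q⊆Q-v y y∈q)) , proj₂ (q⊆Q-v y y∈q) })
  ...   | yes refl = inj₁ (Avoiding-there u∈S u~u′ (suffix-avoiding Q z∈Q u∉Q))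

module GoodSets (G : Graph n) where
  open Walks G

  joined-via : ∀ {T} (h : Fin n) → (∀ z → z ∈ T → PathIn G T z h) → AllJoined G T
  joined-via h to-h u v u∈T v∈T = to-h u u∈T ++ reverse (to-h v v∈T)

  joined-cover : ∀ {R S T h} → S ⊆ R → T ⊆ R → (∀ {z} → z ∈ R → z ∈ S ⊎ z ∈ T) →
                 AllJoined G S → AllJoined G T → h ∈ S → h ∈ T → AllJoined G R
  joined-cover {R} {h = h} S⊆R T⊆R R⊆S∪T S-joined T-joined h∈S h∈T = joined-via h to-h
    where
    to-h : ∀ z → z ∈ R → PathIn G R z h
    to-h z z∈R with R⊆S∪T z∈R
    ... | inj₁ z∈S = PathIn-mono S⊆R (S-joined z h z∈S h∈S)
    ... | inj₂ z∈T = PathIn-mono T⊆R (T-joined z h z∈T h∈T)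

  Good⇒joined∖ : ∀ {S} → Good G S → ∀ v → AllJoined G (S ∖ v)
  Good⇒joined∖ {S} ((_ , S-joined) , S-nocut) v with v ∈? S
  ... | yes v∈S = S-nocut v v∈S
  ... | no v∉S  = λ a b a∈ b∈ → PathIn-mono S⊆S∖v (S-joined a b (x∈p∖y⇒x∈p a∈) (x∈p∖y⇒x∈p b∈))
    where
    S⊆S∖v : S ⊆ S ∖ v
    S⊆S∖v z∈S = x∈p∧x≢y⇒x∈p∖y z∈S (λ { refl → v∉S z∈S })

  Good-∪ : ∀ {S T p q} → Good G S → Good G T → p ≢ q → p ∈ S → q ∈ S → p ∈ T → q ∈ T → Good G (S ∪ T)
  Good-∪ {S} {T} {p} {q} S-good@((_ , S-joined) , _) T-good@((_ , T-joined) , _) p≢q p∈S q∈S p∈T q∈T =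
    ((p , x∈p∪q⁺ (inj₁ p∈S)) , joined-cover (p⊆p∪q T) (q⊆p∪q S T) (x∈p∪q⁻ S T) S-joined T-joined p∈S p∈T) ,
    no-cut
    where
    joined∖ : ∀ {h v} → h ∈ S → h ∈ T → h ≢ v → AllJoined G ((S ∪ T) ∖ v)
    joined∖ {v = v} h∈S h∈T h≢v =
      joined-cover (∖-mono (p⊆p∪q T)) (∖-mono (q⊆p∪q S T)) (x∈p∪q∖y⁻ S T)
                   (Good⇒joined∖ S-good v) (Good⇒joined∖ T-good v)
                   (x∈p∧x≢y⇒x∈p∖y h∈S h≢v) (x∈p∧x≢y⇒x∈p∖y h∈T h≢v)
    no-cut : NoCutVertex G (S ∪ T)
    no-cut v _ with p ≟ v
    ... | no p≢v  = joined∖ p∈S p∈T p≢v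
    ... | yes refl = joined∖ q∈S q∈T (p≢q ∘ sym)

  joined-edge : ∀ {R a b} → a ~ b → (∀ {z} → z ∈ R → z ≡ a ⊎ z ≡ b) → AllJoined G R
  joined-edge {R} a~b R⊆ab u v u∈R v∈R with R⊆ab u∈R | R⊆ab v∈R
  ... | inj₁ refl | inj₁ refl = here u∈R
  ... | inj₂ refl | inj₂ refl = here u∈R
  ... | inj₁ refl | inj₂ refl = there u∈R a~b (here v∈R)
  ... | inj₂ refl | inj₁ refl = there u∈R (~-sym a~b) (here v∈R)

  Good-edge : ∀ {a b} → a ~ b → Good G (⁅ a ⁆ ∪ ⁅ b ⁆)
  Good-edge {a} a~b = ((a , x∈p∪q⁺ (inj₁ (x∈⁅x⁆ a))) , joined-edge a~b x∈⁅y⁆∪⁅z⁆⁻) ,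
                      λ _ _ → joined-edge a~b (x∈⁅y⁆∪⁅z⁆⁻ ∘ x∈p∖y⇒x∈p)

  Good-ear : ∀ {B c₁ c₂ u} → Good G B → c₁ ∈ B → c₂ ∈ B → c₁ ≢ c₂ → c₁ ~ u →
             (Q : PathIn G (∁ B ∪ ⁅ c₂ ⁆) u c₂) → Simple Q → Good G (B ∪ vertices Q)
  Good-ear {B} {c₁} {c₂} {u} B-good@((_ , B-joined) , _) c₁∈B c₂∈B c₁≢c₂ c₁~u Q Q-simple =
    ((c₁ , x∈p∪q⁺ (inj₁ c₁∈B)) , joined-via c₂ to-c₂) , no-cut
    where
    B∪Q : Subset n
    B∪Q = B ∪ vertices Q

    B⊆B∪Q : B ⊆ B∪Q
    B⊆B∪Q = p⊆p∪q (vertices Q)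

    Q⊆B∪Q : ∀ {y} → y ∈ᵥ Q → y ∈ B∪Q
    Q⊆B∪Q y∈Q = x∈p∪q⁺ (inj₂ (∈vertices⁺ Q y∈Q))

    Q∩B⊆c₂ : ∀ {y} → y ∈ᵥ Q → y ∈ B → y ≡ c₂
    Q∩B⊆c₂ y∈Q y∈B with x∈p∪q⁻ (∁ B) ⁅ c₂ ⁆ (∈ᵥ⇒∈ Q y∈Q)
    ... | inj₁ y∈∁B = ⊥-elim (x∈∁p⇒x∉p y∈∁B y∈B)
    ... | inj₂ y∈c₂ = x∈⁅y⁆⇒x≡y c₂ y∈c₂

    to-c₂ : ∀ z → z ∈ B∪Q → PathIn G B∪Q z c₂
    to-c₂ z z∈B∪Q with x∈p∪q⁻ B (vertices Q) z∈B∪Q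
    ... | inj₁ z∈B = PathIn-mono B⊆B∪Q (B-joined z c₂ z∈B c₂∈B)
    ... | inj₂ z∈Q with suffix Q (∈vertices⁻ Q z∈Q)
    ...   | q , q⊆Q = restrict q (λ y y∈q → Q⊆B∪Q (q⊆Q y y∈q))

    in-B : ∀ {v a b} → a ∈ B → b ∈ B → a ≢ v → b ≢ v → PathIn G (B∪Q ∖ v) a b
    in-B {v} a∈B b∈B a≢v b≢v =
      PathIn-mono (∖-mono B⊆B∪Q) (Good⇒joined∖ B-good v _ _ (x∈p∧x≢y⇒x∈p∖y a∈B a≢v) (x∈p∧x≢y⇒x∈p∖y b∈B b≢v))

    along : ∀ {v a b} → Avoiding Q v a b → PathIn G (B∪Q ∖ v) a b
    along (q , q⊆Q∖v) = restrict q (λ y y∈q → x∈p∧x≢y⇒x∈p∖y (Q⊆B∪Q (proj₁ (q⊆Q∖v y y∈q))) (proj₂ (q⊆Q∖v y y∈q)))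

    no-cut : NoCutVertex G B∪Q
    no-cut v _ with v ≟ c₁
    ... | yes refl = joined-via c₂ to-c₂∖v
      where
      v∉Q : ¬ (v ∈ᵥ Q)
      v∉Q v∈Q = c₁≢c₂ (Q∩B⊆c₂ v∈Q c₁∈B)
      to-c₂∖v : ∀ z → z ∈ B∪Q ∖ v → PathIn G (B∪Q ∖ v) z c₂
      to-c₂∖v z z∈B∪Q∖v with x∈p∪q⁻ B (vertices Q) (x∈p∖y⇒x∈p z∈B∪Q∖v)
      ... | inj₁ z∈B = in-B z∈B c₂∈B (x∈p∖y⇒x≢y z∈B∪Q∖v) (c₁≢c₂ ∘ sym)
      ... | inj₂ z∈Q = along (suffix-avoiding Q (∈vertices⁻ Q z∈Q) v∉Q)
    ... | no v≢c₁ = joined-via c₁ to-c₁∖v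
      where
      to-c₁∖v : ∀ z → z ∈ B∪Q ∖ v → PathIn G (B∪Q ∖ v) z c₁
      to-c₁∖v z z∈B∪Q∖v with x∈p∪q⁻ B (vertices Q) (x∈p∖y⇒x∈p z∈B∪Q∖v)
      ... | inj₁ z∈B = in-B z∈B c₁∈B (x∈p∖y⇒x≢y z∈B∪Q∖v) (v≢c₁ ∘ sym)
      ... | inj₂ z∈Q with simple-split Q Q-simple (∈vertices⁻ Q z∈Q) (x∈p∖y⇒x≢y z∈B∪Q∖v)
      ...   | inj₁ seg@(q , q⊆Q∖v) = along seg ++ in-B c₂∈B c₁∈B c₂≢v (v≢c₁ ∘ sym)
        where
        c₂≢v : c₂ ≢ v
        c₂≢v = proj₂ (q⊆Q∖v c₂ (last∈ᵥ q))
      ...   | inj₂ from-u = snoc (reverse (along from-u)) (~-sym c₁~u) (x∈p∧x≢y⇒x∈p∖y (B⊆B∪Q c₁∈B) (v≢c₁ ∘ sym))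

module Blocks (G : Graph n) where
  open Walks G
  open GoodSets G

  block-absorbs : ∀ {B T p q} → IsBlock G B → Good G T → p ≢ q → p ∈ B → q ∈ B → p ∈ T → q ∈ T → T ⊆ B
  block-absorbs {B} {T} (B-good , B-max) T-good p≢q p∈B q∈B p∈T q∈T {z} z∈T with z ∈? B
  ... | yes z∈B = z∈B
  ... | no z∉B  = ⊥-elim (B-max (B ∪ T) (p⊆p∪q T , z , x∈p∪q⁺ (inj₂ z∈T) , z∉B)
                                (Good-∪ B-good T-good p≢q p∈B q∈B p∈T q∈T))

  block-unique : ∀ {B B′ p q} → IsBlock G B → IsBlock G B′ → p ≢ q →
                 p ∈ B → q ∈ B → p ∈ B′ → q ∈ B′ → B ≡ B′
  block-unique B-block B′-block p≢q p∈B q∈B p∈B′ q∈B′ =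
    ⊆-antisym (block-absorbs B′-block (proj₁ B-block) p≢q p∈B′ q∈B′ p∈B q∈B)
              (block-absorbs B-block (proj₁ B′-block) p≢q p∈B q∈B p∈B′ q∈B′)

  block-∃≢ : ∀ {B c w} → IsBlock G B → c ∈ B → c ~ w → ∃[ b ] (b ∈ B × b ≢ c)
  block-∃≢ {B} {c} {w} (_ , B-max) c∈B c~w with any? (λ b → (b ∈? B) ×-dec ¬? (b ≟ c))
  ... | yes found = found
  ... | no ¬found = ⊥-elim (B-max (⁅ c ⁆ ∪ ⁅ w ⁆) (B⊆cw , w , x∈p∪q⁺ (inj₂ (x∈⁅x⁆ w)) , w∉B) (Good-edge c~w))
    where
    B⊆c : ∀ {z} → z ∈ B → z ≡ c
    B⊆c {z} z∈B with z ≟ c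
    ... | yes z≡c = z≡c
    ... | no z≢c  = ⊥-elim (¬found (z , z∈B , z≢c))
    B⊆cw : B ⊆ ⁅ c ⁆ ∪ ⁅ w ⁆
    B⊆cw z∈B with B⊆c z∈B
    ... | refl = x∈p∪q⁺ (inj₁ (x∈⁅x⁆ c))
    w∉B : w ∉ B
    w∉B w∈B = ~⇒≢ c~w (sym (B⊆c w∈B))

  ExitPath : Subset n → Fin n → Fin n → Set
  ExitPath B c y = ∃[ u ] (c ~ u × PathIn G (∁ B) u y)

  -- two distinct exits to the same vertex would close an ear, contradicting maximality
  exit-unique : ∀ {B c₁ c₂ y} → IsBlock G B → c₁ ∈ B → c₂ ∈ B → ExitPath B c₁ y → ExitPath B c₂ y → c₁ ≡ c₂
  exit-unique {B} {c₁} {c₂} (B-good , B-max) c₁∈B c₂∈B (u₁ , c₁~u₁ , p₁) (u₂ , c₂~u₂ , p₂) with c₁ ≟ c₂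
  ... | yes c₁≡c₂ = c₁≡c₂
  ... | no c₁≢c₂  with simplify (snoc (PathIn-mono (p⊆p∪q ⁅ c₂ ⁆) (p₁ ++ reverse p₂)) (~-sym c₂~u₂)
                                     (x∈p∪q⁺ (inj₂ (x∈⁅x⁆ c₂))))
  ...   | Q , Q-simple =
          ⊥-elim (B-max (B ∪ vertices Q) (p⊆p∪q (vertices Q) , u₁ , x∈p∪q⁺ (inj₂ (∈vertices⁺ Q (head∈ᵥ Q))) , u₁∉B)
                        (Good-ear B-good c₁∈B c₂∈B c₁≢c₂ c₁~u₁ Q Q-simple))
    where
    u₁∉B : u₁ ∉ B
    u₁∉B = x∈∁p⇒x∉p (head∈ p₁)

  last-exit : ∀ {S u w} (B : Subset n) → PathIn G S u w → w ∉ B →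
              PathIn G (∁ B) u w ⊎ ∃[ c ] (c ∈ B × c ∈ S × ExitPath B c w)
  last-exit B (here _) w∉B = inj₁ (here (x∉p⇒x∈∁p w∉B))
  last-exit B (there {u} {u′} u∈S u~u′ p) w∉B with last-exit B p w∉B
  ... | inj₂ exit = inj₂ exit
  ... | inj₁ q with u ∈? B
  ...   | yes u∈B = inj₂ (u , u∈B , u∈S , u′ , u~u′ , q)
  ...   | no u∉B  = inj₁ (there (x∉p⇒x∈∁p u∉B) u~u′ q)

  exit-separates : ∀ {B c b y} → IsBlock G B → c ∈ B → b ∈ B → y ∉ B → ExitPath B c y →
                   ¬ PathIn G (∁ ⁅ c ⁆) b y
  exit-separates {c = c} B-block c∈B b∈B y∉B exit p with last-exit _ p y∉B
  ... | inj₁ q = x∈∁p⇒x∉p (head∈ q) b∈B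
  ... | inj₂ (c′ , c′∈B , c′∈∁c , exit′) =
        x∈∁p⇒x∉p c′∈∁c (subst (_∈ ⁅ c ⁆) (exit-unique B-block c∈B c′∈B exit exit′) (x∈⁅x⁆ c))

module Percolation (G : Graph n) (r : ℕ) (A : Subset n) where
  open Walks G

  I : ℕ → Subset n
  I = infected G r A

  step-∈⁻ : ∀ {S v} → v ∈ step G r S → v ∈ S ⊎ r ≤ ∣ N G v ∩ S ∣
  step-∈⁻ {S} {v} v∈ with lookup S v in v∈S | tabulate-∈⁻ (λ w → lookup S w ∨ (r ≤ᵇ ∣ N G w ∩ S ∣)) v∈
  ... | true  | _  = inj₁ (lookup⇒[]= v S v∈S)
  ... | false | r≤ = inj₂ (≤ᵇ⇒≤ r _ (subst T (sym r≤) tt))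

  N∩-∈⁻ : ∀ {S v w} → w ∈ N G v ∩ S → v ~ w × w ∈ S
  N∩-∈⁻ {S} {v} w∈ with x∈p∩q⁻ (N G v) S w∈
  ... | w∈N , w∈S = tabulate-∈⁻ (adj G v) w∈N , w∈S

  never-infected : 2 ≤ r → (D : Fin n → Set) (c : Fin n) → (∀ {v w} → D v → v ~ w → w ≢ c → D w) →
                   (∀ {v} → D v → v ∉ A) → ∀ t {v} → D v → v ∉ I t
  never-infected 2≤r D c D-closed D∩A=∅ zero    v∈D v∈A = D∩A=∅ v∈D v∈A
  never-infected 2≤r D c D-closed D∩A=∅ (suc t) {v} v∈D v∈I with step-∈⁻ v∈I
  ... | inj₁ v∈Iₜ = never-infected 2≤r D c D-closed D∩A=∅ t v∈D v∈Iₜ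
  ... | inj₂ r≤ with 2≤∣p∣⇒∃≢ (N G v ∩ I t) c (≤-trans 2≤r r≤)
  ...   | w , w∈ , w≢c with N∩-∈⁻ w∈
  ...     | v~w , w∈Iₜ = never-infected 2≤r D c D-closed D∩A=∅ t (D-closed v∈D v~w w≢c) w∈Iₜ

  A-reachable-avoiding : 2 ≤ r → Percolates G r A → ∀ {b c} → b ≢ c →
                         ¬ (∀ {a} → a ∈ A → ¬ PathIn G (∁ ⁅ c ⁆) b a)
  A-reachable-avoiding 2≤r (t , percolated) {b} {c} b≢c unreachable =
    never-infected 2≤r (PathIn G (∁ ⁅ c ⁆) b) c extend (λ p a∈A → unreachable a∈A p) t
                   (here (x∉p⇒x∈∁p (x≢y⇒x∉⁅y⁆ b≢c))) (percolated b)
    where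
    extend : ∀ {v w} → PathIn G (∁ ⁅ c ⁆) b v → v ~ w → w ≢ c → PathIn G (∁ ⁅ c ⁆) b w
    extend p v~w w≢c = snoc p v~w (x∉p⇒x∈∁p (x≢y⇒x∉⁅y⁆ w≢c))

  IsApex : Fin n → Set
  IsApex x = x ∉ A × (∀ {a} → a ∈ A → x ~ a)

  -- the first vertex outside A to be infected has r = ∣ A ∣ infected neighbours, so all of A
  first-outside : ∣ A ∣ ≡ r → ∀ t → I t ⊆ A ⊎ ∃[ x ] IsApex x
  first-outside ∣A∣≡r zero = inj₁ λ v∈A → v∈A
  first-outside ∣A∣≡r (suc t) with first-outside ∣A∣≡r t
  ... | inj₂ apex = inj₂ apex
  ... | inj₁ Iₜ⊆A with any? (λ v → (v ∈? I (suc t)) ×-dec ¬? (v ∈? A))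
  ...   | no ¬new = inj₁ λ {v} v∈ → decidable-stable (v ∈? A) (λ v∉A → ¬new (v , v∈ , v∉A))
  ...   | yes (v , v∈ , v∉A) = inj₂ (v , v∉A , λ a∈A → proj₁ (N∩-∈⁻ (A⊆N∩Iₜ a∈A)))
    where
    r≤ : r ≤ ∣ N G v ∩ I t ∣
    r≤ with step-∈⁻ v∈
    ... | inj₁ v∈Iₜ = ⊥-elim (v∉A (Iₜ⊆A v∈Iₜ))
    ... | inj₂ r≤   = r≤
    A⊆N∩Iₜ : A ⊆ N G v ∩ I t
    A⊆N∩Iₜ = p⊆q∧∣q∣≤∣p∣⇒q⊆p (λ w∈ → Iₜ⊆A (proj₂ (N∩-∈⁻ w∈))) (≤-trans (≤-reflexive ∣A∣≡r) r≤)

  apex-exists : ∣ A ∣ ≡ r → Percolates G r A → r < n → ∃[ x ] IsApex x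
  apex-exists ∣A∣≡r (t , percolated) r<n with first-outside ∣A∣≡r t
  ... | inj₂ apex = apex
  ... | inj₁ Iₜ⊆A = ⊥-elim (<-irrefl refl (<-≤-trans r<n n≤r))
    where
    n≤r : n ≤ r
    n≤r = ≤-trans (≤-reflexive (sym (∣⊤∣≡n n)))
                  (≤-trans (p⊆q⇒∣p∣≤∣q∣ {p = ⊤} (λ {v} _ → Iₜ⊆A (percolated v))) (≤-reflexive ∣A∣≡r))

  joined-to-apex : ∀ {x} → IsApex x → 1 ≤ r → ∀ t {v} → v ∈ I t → PathIn G ⊤ v x
  joined-to-apex (_ , x~A) 1≤r zero    v∈A = there ∈⊤ (~-sym (x~A v∈A)) (here ∈⊤)
  joined-to-apex x-apex    1≤r (suc t) {v} v∈I with step-∈⁻ v∈I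
  ... | inj₁ v∈Iₜ = joined-to-apex x-apex 1≤r t v∈Iₜ
  ... | inj₂ r≤ with 1≤∣p∣⇒nonempty (N G v ∩ I t) (≤-trans 1≤r r≤)
  ...   | w , w∈ with N∩-∈⁻ w∈
  ...     | v~w , w∈Iₜ = there ∈⊤ v~w (joined-to-apex x-apex 1≤r t w∈Iₜ)

module Apex {G : Graph n} {r : ℕ} {A : Subset n} (2≤r : 2 ≤ r) (∣A∣≡r : ∣ A ∣ ≡ r)
            (A-percolates : Percolates G r A) {x : Fin n} (x-apex : Percolation.IsApex G r A x) where
  open Walks G
  open GoodSets G
  open Blocks G
  open Percolation G r A

  x∉A : x ∉ A
  x∉A = proj₁ x-apex

  x~A : ∀ {a} → a ∈ A → x ~ a
  x~A = proj₂ x-apex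

  A∌x : ∀ {a} → a ∈ A → x ≢ a
  A∌x a∈A refl = x∉A a∈A

  to-apex : ∀ v → PathIn G ⊤ v x
  to-apex v = joined-to-apex x-apex (≤-trans (s≤s z≤n) 2≤r) (proj₁ A-percolates) (proj₂ A-percolates v)

  has-neighbour : ∀ v → ∃[ w ] v ~ w
  has-neighbour v with to-apex v
  ... | there _ v~w _ = _ , v~w
  ... | here _ with 1≤∣p∣⇒nonempty A (≤-trans (s≤s z≤n) (≤-trans 2≤r (≤-reflexive (sym ∣A∣≡r))))
  ...   | a , a∈A = a , x~A a∈A

  apex∈block : ∀ {B} → IsBlock G B → x ∈ B
  apex∈block {B} B-block with x ∈? B
  ... | yes x∈B = x∈B
  ... | no x∉B with proj₁ (proj₁ (proj₁ B-block))
  ...   | b₀ , b₀∈B with last-exit B (to-apex b₀) x∉B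
  ...     | inj₁ q = ⊥-elim (x∈∁p⇒x∉p (head∈ q) b₀∈B)
  ...     | inj₂ (c , c∈B , _ , exit) with block-∃≢ B-block c∈B (proj₂ (has-neighbour c))
  ...       | b , b∈B , b≢c = ⊥-elim (A-reachable-avoiding 2≤r A-percolates b≢c λ a∈A p →
                exit-separates B-block c∈B b∈B x∉B exit
                  (snoc p (~-sym (x~A a∈A)) (x∉p⇒x∈∁p (x≢y⇒x∉⁅y⁆ λ { refl → x∉B c∈B }))))

  block∩A : ∀ {B} → IsBlock G B → ∃[ a ] (a ∈ A × a ∈ B)
  block∩A {B} B-block with any? (λ a → (a ∈? A) ×-dec (a ∈? B))
  ... | yes found = found
  ... | no ¬found with block-∃≢ B-block (apex∈block B-block) (proj₂ (has-neighbour x))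
  ...   | b , b∈B , b≢x = ⊥-elim (A-reachable-avoiding 2≤r A-percolates b≢x λ {a} a∈A →
            exit-separates B-block (apex∈block B-block) b∈B (a∉B a∈A) (a , x~A a∈A , here (x∉p⇒x∈∁p (a∉B a∈A))))
    where
    a∉B : ∀ {a} → a ∈ A → a ∉ B
    a∉B a∈A a∈B = ¬found (_ , a∈A , a∈B)

  module Enumeration {k : ℕ} (B : Fin k → Subset n) (B-injective : Injective _≡_ _≡_ B)
                     (B-blocks : ∀ i → IsBlock G (B i)) where

    rep : Fin k → Fin n
    rep i = proj₁ (block∩A (B-blocks i))

    rep∈A : ∀ i → rep i ∈ A
    rep∈A i = proj₁ (proj₂ (block∩A (B-blocks i)))

    rep∈B : ∀ i → rep i ∈ B i
    rep∈B i = proj₂ (proj₂ (block∩A (B-blocks i)))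

    same-block : ∀ {i j a} → a ∈ A → a ∈ B i → a ∈ B j → i ≡ j
    same-block a∈A a∈Bi a∈Bj =
      B-injective (block-unique (B-blocks _) (B-blocks _) (A∌x a∈A)
                                (apex∈block (B-blocks _)) a∈Bi (apex∈block (B-blocks _)) a∈Bj)

    rep-injective : Injective _≡_ _≡_ rep
    rep-injective {i} {j} repi≡repj = same-block (rep∈A i) (rep∈B i) (subst (_∈ B j) (sym repi≡repj) (rep∈B j))

    k≤r : k ≤ r
    k≤r = ≤-trans (injection⇒≤∣p∣ A rep rep-injective rep∈A) (≤-reflexive ∣A∣≡r)

  module Exactly-r-Blocks (3≤r : 3 ≤ r) (B : Fin r → Subset n) (B-injective : Injective _≡_ _≡_ B)
                          (B-blocks : ∀ i → IsBlock G (B i)) where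
    open Enumeration B B-injective B-blocks

    rep-onto : ∀ {a} → a ∈ A → ∃[ i ] rep i ≡ a
    rep-onto = injection-onto A rep rep-injective rep∈A (≤-reflexive ∣A∣≡r)

    -- the block of a′ absorbs T, so it contains a and is the block of a
    A∩good-through-apex-unique : ∀ {T a a′} → Good G T → x ∈ T → a ∈ T → a′ ∈ T → a ∈ A → a′ ∈ A → a ≡ a′
    A∩good-through-apex-unique T-good x∈T a∈T a′∈T a∈A a′∈A with rep-onto a∈A | rep-onto a′∈A
    ... | i , refl | j , refl =
          cong rep (same-block a∈A (rep∈B i)
                               (block-absorbs (B-blocks j) T-good (A∌x a′∈A) (apex∈block (B-blocks j)) (rep∈B j)
                                              x∈T a′∈T a∈T))

    ear-through-A : ∀ {a a′} → a ∈ A → a′ ∈ A → (Q : PathIn G (∁ (⁅ x ⁆ ∪ ⁅ a ⁆) ∪ ⁅ a ⁆) a′ a) →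
                    Simple Q → a ≡ a′
    ear-through-A {a} {a′} a∈A a′∈A Q Q-simple =
      A∩good-through-apex-unique (Good-ear (Good-edge (x~A a∈A)) x∈xa a∈xa (A∌x a∈A) (x~A a′∈A) Q Q-simple)
                        (x∈p∪q⁺ (inj₁ x∈xa)) (x∈p∪q⁺ (inj₁ a∈xa)) (x∈p∪q⁺ (inj₂ (∈vertices⁺ Q (head∈ᵥ Q))))
                        a∈A a′∈A
      where
      x∈xa : x ∈ ⁅ x ⁆ ∪ ⁅ a ⁆
      x∈xa = x∈p∪q⁺ (inj₁ (x∈⁅x⁆ x))
      a∈xa : a ∈ ⁅ x ⁆ ∪ ⁅ a ⁆
      a∈xa = x∈p∪q⁺ (inj₂ (x∈⁅x⁆ a))

    outside-xa : ∀ {a v} → v ≢ x → v ≢ a → v ∉ ⁅ x ⁆ ∪ ⁅ a ⁆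
    outside-xa v≢x v≢a v∈xa = [ v≢x , v≢a ]′ (x∈⁅y⁆∪⁅z⁆⁻ v∈xa)

    inner-ear-vertex : ∀ {a v} → v ≢ x → v ≢ a → v ∈ ∁ (⁅ x ⁆ ∪ ⁅ a ⁆) ∪ ⁅ a ⁆
    inner-ear-vertex v≢x v≢a = x∈p∪q⁺ (inj₁ (x∉p⇒x∈∁p (outside-xa v≢x v≢a)))

    last-ear-vertex : ∀ {a} → a ∈ ∁ (⁅ x ⁆ ∪ ⁅ a ⁆) ∪ ⁅ a ⁆
    last-ear-vertex {a} = x∈p∪q⁺ (inj₂ (x∈⁅x⁆ a))

    A-independent : ∀ {a a′} → a ∈ A → a′ ∈ A → ¬ (a′ ~ a)
    A-independent {a} {a′} a∈A a′∈A a′~a =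
      ~⇒≢ a′~a (sym (ear-through-A a∈A a′∈A Q (~⇒≢ a′~a , tt)))
      where
      Q : PathIn G (∁ (⁅ x ⁆ ∪ ⁅ a ⁆) ∪ ⁅ a ⁆) a′ a
      Q = there (inner-ear-vertex (A∌x a′∈A ∘ sym) (~⇒≢ a′~a)) a′~a (here last-ear-vertex)

    A-no-common-neighbour : ∀ {a a′ v} → a ∈ A → a′ ∈ A → a ≢ a′ → v ∉ A → v ≢ x → v ~ a → v ~ a′ → ⊥
    A-no-common-neighbour {a} {a′} {v} a∈A a′∈A a≢a′ v∉A v≢x v~a v~a′ =
      a≢a′ (ear-through-A a∈A a′∈A Q ([ a′≢v , a′≢a ]′ , ~⇒≢ v~a , tt))
      where
      a′≢x : a′ ≢ x
      a′≢x = A∌x a′∈A ∘ sym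
      a′≢a : a′ ≢ a
      a′≢a = a≢a′ ∘ sym
      a′≢v : a′ ≢ v
      a′≢v refl = v∉A a′∈A
      Q : PathIn G (∁ (⁅ x ⁆ ∪ ⁅ a ⁆) ∪ ⁅ a ⁆) a′ a
      Q = there (inner-ear-vertex a′≢x a′≢a) (~-sym v~a′)
                (there (inner-ear-vertex v≢x (~⇒≢ v~a)) v~a (here last-ear-vertex))

    -- a newly infected vertex outside A needs two infected neighbours other than x, both in A
    infected⊆x∪A : ∀ t {v} → v ∈ I t → v ≡ x ⊎ v ∈ A
    infected⊆x∪A zero    v∈A = inj₂ v∈A
    infected⊆x∪A (suc t) {v} v∈I with step-∈⁻ v∈I
    ... | inj₁ v∈Iₜ = infected⊆x∪A t v∈Iₜ
    ... | inj₂ r≤ with v ≟ x | v ∈? A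
    ...   | yes v≡x | _       = inj₁ v≡x
    ...   | no _    | yes v∈A = inj₂ v∈A
    ...   | no v≢x  | no v∉A  with 3≤∣p∣⇒∃₂≢ (N G v ∩ I t) x (≤-trans 3≤r r≤)
    ...     | a , a′ , a∈ , a′∈ , a≢a′ =
              ⊥-elim (A-no-common-neighbour (in-A a∈) (in-A a′∈) a≢a′ v∉A v≢x (v~ a∈) (v~ a′∈))
      where
      v~ : ∀ {w} → w ∈ (N G v ∩ I t) ∖ x → v ~ w
      v~ w∈ = proj₁ (N∩-∈⁻ (x∈p∖y⇒x∈p w∈))
      in-A : ∀ {w} → w ∈ (N G v ∩ I t) ∖ x → w ∈ A
      in-A w∈ with infected⊆x∪A t (proj₂ (N∩-∈⁻ (x∈p∖y⇒x∈p w∈)))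
      ... | inj₁ w≡x = ⊥-elim (x∈p∖y⇒x≢y w∈ w≡x)
      ... | inj₂ w∈A = w∈A

    vertex∈A : ∀ {v} → v ≢ x → v ∈ A
    vertex∈A {v} v≢x with infected⊆x∪A (proj₁ A-percolates) (proj₂ A-percolates v)
    ... | inj₁ v≡x = ⊥-elim (v≢x v≡x)
    ... | inj₂ v∈A = v∈A

    to-star : Fin n → Fin (suc r)
    to-star v with v ≟ x
    ... | yes _   = zero
    ... | no v≢x = suc (proj₁ (rep-onto (vertex∈A v≢x)))

    from-star : Fin (suc r) → Fin n
    from-star zero    = x
    from-star (suc i) = rep i

    to∘from : ∀ i → to-star (from-star i) ≡ i
    to∘from zero with x ≟ x
    ... | yes _  = refl
    ... | no x≢x = ⊥-elim (x≢x refl)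
    to∘from (suc i) with rep i ≟ x
    ... | yes repi≡x = ⊥-elim (A∌x (rep∈A i) (sym repi≡x))
    ... | no repi≢x  = cong suc (rep-injective (proj₂ (rep-onto (vertex∈A repi≢x))))

    from∘to : ∀ v → from-star (to-star v) ≡ v
    from∘to v with v ≟ x
    ... | yes v≡x = sym v≡x
    ... | no v≢x  = proj₂ (rep-onto (vertex∈A v≢x))

    from-star-adj : ∀ i j → adj G (from-star i) (from-star j) ≡ adj (Star r) i j
    from-star-adj zero    zero    = irrefl G x
    from-star-adj zero    (suc j) = x~A (rep∈A j)
    from-star-adj (suc i) zero    = ~-sym (x~A (rep∈A i))
    from-star-adj (suc i) (suc j) with adj G (rep i) (rep j) in repi~repj
    ... | false = refl
    ... | true  = ⊥-elim (A-independent (rep∈A j) (rep∈A i) repi~repj)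

    ≅-star : G ≅ Star r
    ≅-star = mk↔ₛ′ to-star from-star to∘from from∘to , λ u v →
      trans (cong₂ (adj G) (sym (from∘to u)) (sym (from∘to v))) (from-star-adj (to-star u) (to-star v))

mainTheorem5 : (r n : ℕ) → 2 ≤ r → (G : Graph n) → BootstrapGood G r → suc r ≤ n →
    (∀ k → NumBlocks G k → k ≤ r)
    × (3 ≤ r → NumBlocks G r → G ≅ Star r)
mainTheorem5 r n 2≤r G (A , ∣A∣≡r , A-percolates) r<n = at-most-r-blocks , r-blocks⇒star
  where
  apex : ∃[ x ] Percolation.IsApex G r A x
  apex = Percolation.apex-exists G r A ∣A∣≡r A-percolates r<n

  open Apex 2≤r ∣A∣≡r A-percolates (proj₂ apex)

  at-most-r-blocks : ∀ k → NumBlocks G k → k ≤ r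
  at-most-r-blocks k (B , B-injective , B-blocks , _) = Enumeration.k≤r B B-injective B-blocks

  r-blocks⇒star : 3 ≤ r → NumBlocks G r → G ≅ Star r
  r-blocks⇒star 3≤r (B , B-injective , B-blocks , _) = Exactly-r-Blocks.≅-star 3≤r B B-injective B-blocks
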